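{- Let $w\in W_{n,r}$, let $S=\{e_1<\dots<e_n\}$ and $M=M_w$. If $\mathfrak{S}_n$ is given the (strong) Bruhat order, then $\lambda_M\colon\mathfrak{S}_n\to W_{n,r}$ is order-reversing: $\sigma\le\tau$ in Bruhat order implies $\lambda_M(\sigma)\ge\lambda_M(\tau)$ in $W_{n,r}$.
   Context: $W_{n,r}$ is the set of words of length $n$ on $\{0,1\}$ with exactly $r$ ones; $\pi_k(w)$ is the position of the $k$-th $1$ in $w$; $v\le w$ in $W_{n,r}$ iff $\pi_k(v)\le\pi_k(w)$ for all $k$. $M_w$ is the matroid on $S$ whose independent sets are the $I$ with $|I\cap S_i|\le i$ for $0\le i\le r$, where $S_r=S$, $S_{k-1}=\{e_1,\dots,e_{\pi_k(w)-1}\}$. The distinguished word of a matroid on a linearly ordered set $\{f_1<\dots<f_n\}$ is $x_1\cdots x_n$ with $x_i=0$ if $f_i$ lies in the closure of $\{f_1,\dots,f_{i-1}\}$ and $x_i=1$ otherwise. $\mathfrak{S}_n$ acts on $S$ by $\sigma(e_i)=e_{\sigma(i)}$, $S_\sigma$ is $S$ ordered by $\sigma(e_1)<\dots<\sigma(e_n)$, and $\lambda_M(\sigma)$ is the distinguished word of $M$ on $S_\sigma$. The Bruhat order on $\mathfrak{S}_n$ (permutations written as words $\tau_1\cdots\tau_n$) is generated by covering relations: $\sigma$ covers $\tau$ iff $\sigma$ is obtained from $\tau$ by exchanging entries $\tau_i,\tau_j$ with $i<j$, $\tau_i<\tau_j$, and the number of inversions increases by exactly one. -}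

module Defs where

open import Data.Nat using (ℕ; zero; suc; _+_; _≤_; _<_; _<ᵇ_)
open import Data.Bool using (Bool; true; false; _∧_; if_then_else_)
open import Data.Fin using (Fin; toℕ)
open import Data.Fin.Subset using (Subset; _⊆_; _∪_; _∩_; ⁅_⁆; ∣_∣)
open import Data.Fin.Permutation using (Permutation′; _⟨$⟩ʳ_; _⟨$⟩ˡ_)
open import Data.Fin.Permutation.Components using (transpose)
open import Data.Vec using (Vec; []; _∷_; lookup; tabulate)
open import Data.List using (List; map)
open import Data.Nat.ListAction using (sum)
open import Data.List using () renaming (allFin to allFinL)
open import Data.Product using (Σ; _×_; ∃; ∃-syntax)
open import Function.Bundles using (_⇔_)
open import Relation.Binary.PropositionalEquality using (_≡_)
open import Relation.Binary.Construct.Closure.ReflexiveTransitive using (Star)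

-- Words on {0,1}: Vec Bool n, with true = 1, false = 0.

ones : ∀ {n} → Vec Bool n → ℕ
ones []          = 0
ones (true  ∷ w) = suc (ones w)
ones (false ∷ w) = ones w

InW : (n r : ℕ) → Vec Bool n → Set
InW n r w = ones w ≡ r

-- pos w k = π_{k+1}(w) - 1, i.e. the 0-based position of the (k+1)-th one
-- (meaningful for k < ones w; junk value otherwise).
pos : ∀ {n} → Vec Bool n → ℕ → ℕ
pos []          k       = 0
pos (true  ∷ w) zero    = 0
pos (true  ∷ w) (suc k) = suc (pos w k)
pos (false ∷ w) k       = suc (pos w k)

_≤W[_]_ : ∀ {n} → Vec Bool n → ℕ → Vec Bool n → Set
v ≤W[ r ] w = ∀ k → k < r → pos v k ≤ pos w k

-- Matroids on S = {e_1 < ... < e_n}, identified with Fin n (e_{i+1} ↔ i),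
-- given by their independence predicate on subsets.

IndepPred : ℕ → Set₁
IndepPred n = Subset n → Set

initSeg : ∀ {n} → ℕ → Subset n
initSeg m = tabulate (λ i → toℕ i <ᵇ m)

-- The matroid M_w (for w ∈ W_{n,r}): I independent iff |I ∩ S_i| ≤ i for
-- 0 ≤ i ≤ r, where S_{k-1} = {e_1,...,e_{π_k(w)-1}} (1 ≤ k ≤ r), S_r = S.
-- With k' = k-1 (0-based), S_{k'} = initSeg (pos w k').
Mw : ∀ {n} → ℕ → Vec Bool n → IndepPred n
Mw r w I = (∀ k → k < r → ∣ I ∩ initSeg (pos w k) ∣ ≤ k) × (∣ I ∣ ≤ r)

-- x lies in the closure of A: r(A ∪ {x}) = r(A), where r(X) is the maximal
-- size of an independent subset of X.  (Since r(A) ≤ r(A ∪ {x}) always,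
-- this is r(A ∪ {x}) ≤ r(A), unfolded.)
InClosure : ∀ {n} → IndepPred n → Subset n → Fin n → Set
InClosure Ind A x =
  ∀ I → I ⊆ (A ∪ ⁅ x ⁆) → Ind I → ∃[ J ] (J ⊆ A × Ind J × ∣ I ∣ ≤ ∣ J ∣)

-- Distinguished word of M on S_σ (f_i = σ(e_i) = e_{σ(i)}):
-- x_i = 0 iff f_i ∈ cl{f_1,...,f_{i-1}}.

-- {σ(e_j) : j < i}
prefixσ : ∀ {n} → Permutation′ n → Fin n → Subset n
prefixσ σ i = tabulate (λ e → toℕ (σ ⟨$⟩ˡ e) <ᵇ toℕ i)

IsDistWord : ∀ {n} → IndepPred n → Permutation′ n → Vec Bool n → Set
IsDistWord Ind σ x =
  ∀ i → (lookup x i ≡ false) ⇔ InClosure Ind (prefixσ σ i) (σ ⟨$⟩ʳ i)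

-- Bruhat order on permutations (as words τ(0) τ(1) ... τ(n-1)).

inv : ∀ {n} → Permutation′ n → ℕ
inv {n} τ = sum (map (λ i → sum (map (λ j →
    if (toℕ i <ᵇ toℕ j) ∧ (toℕ (τ ⟨$⟩ʳ j) <ᵇ toℕ (τ ⟨$⟩ʳ i)) then 1 else 0)
  (allFinL n))) (allFinL n))

Covers : ∀ {n} → Permutation′ n → Permutation′ n → Set
Covers {n} σ τ = Σ (Fin n) λ i → Σ (Fin n) λ j →
  (toℕ i < toℕ j) × (toℕ (τ ⟨$⟩ʳ i) < toℕ (τ ⟨$⟩ʳ j)) ×
  (∀ k → σ ⟨$⟩ʳ k ≡ τ ⟨$⟩ʳ (transpose i j k)) × (inv σ ≡ suc (inv τ))

_⋖_ : ∀ {n} → Permutation′ n → Permutation′ n → Set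
τ ⋖ σ = Covers σ τ

_≤B_ : ∀ {n} → Permutation′ n → Permutation′ n → Set
_≤B_ = Star _⋖_

module Submission where

-- The ones of λ_M(σ) count ranks: by the greedy description of the distinguished
-- word, its first m letters contain exactly r(P_m) ones, where P_m is the set of
-- the first m elements of S_σ.  A Bruhat cover τ of σ exchanges two values
-- a < b with a placed before b in σ, so b moves forward.  Every independent
-- subset I of a σ-prefix yields one of the same size in the τ-prefix: either I
-- already lies in it, or b ∉ I and we replace a by b; replacing an element of I
-- by a larger one keeps it independent in M_w, whose constraints only bound
-- |I ∩ S_k| for initial segments S_k.  Hence r(P_m) never decreases along the
-- Bruhat order, λ_M(τ) has at least as many ones as λ_M(σ) in every prefix, and
-- therefore its k-th one comes no later.

open import Defs
open import Data.Bool using (Bool; true; false)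
open import Data.Bool.Properties using (T-≡)
open import Data.Empty using (⊥-elim)
open import Data.Fin using (Fin; toℕ; fromℕ<) renaming (zero to fzero; suc to fsuc)
open import Data.Fin.Properties using (toℕ-fromℕ<; toℕ-injective) renaming (_≟_ to _≟ᶠ_)
open import Data.Fin.Permutation
  using (Permutation′; _⟨$⟩ʳ_; _⟨$⟩ˡ_; inverseˡ; inverseʳ; id; flip; _∘ₚ_)
  renaming (transpose to transposeₚ)
open import Data.Fin.Permutation.Components using (transpose)
open import Data.Fin.Subset using (Subset; _⊆_; _∪_; _∩_; ⁅_⁆; ∣_∣; _∈_; _∉_) renaming (⊥ to ∅)
open import Data.Fin.Subset.Properties
  using (p⊆q⇒∣p∣≤∣q∣; ∣p∣≤∣x∷p∣; ∣⊥∣≡0; ∣⁅x⁆∣≡1; ∣p∩q∣≤∣p∣; ∉⊥; _∈?_; x∈⁅x⁆; x∈⁅y⁆⇒x≡y;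
         x∈p∩q⁺; x∈p∩q⁻; x∈p∪q⁺; x∈p∪q⁻; p∩q⊆p; p∩q⊆q)
open import Data.Nat using (ℕ; zero; suc; _+_; _≤_; _<_; _<ᵇ_; z≤n; s≤s; _≤?_)
open import Data.Nat.Properties
open import Algebra.Properties.CommutativeSemigroup +-commutativeSemigroup using (x∙yz≈y∙xz)
open import Algebra.Properties.CommutativeMonoid.Sum +-0-commutativeMonoid
  using (sum; sum-permute; sum-cong-≗)
open import Data.Product using (_×_; _,_; proj₁; proj₂; ∃-syntax)
open import Data.Sum using (inj₁; inj₂)
open import Data.Vec using (Vec; []; _∷_; lookup; tabulate)
open import Data.Vec.Properties using (lookup∘tabulate; []=⇒lookup; lookup⇒[]=)
open import Function using (_∘_)
open import Function.Bundles using (Equivalence)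
open import Relation.Nullary using (¬_; yes; no; contradiction; ¬¬-map; decidable-stable)
open import Relation.Nullary.Decidable using (dec-true; dec-false)
open import Relation.Binary.PropositionalEquality
  using (_≡_; _≢_; refl; sym; trans; cong; subst; module ≡-Reasoning)
open import Relation.Binary.Construct.Closure.ReflexiveTransitive using (ε; _◅_)

bit : Bool → ℕ
bit true  = 1
bit false = 0

prefixOnes : ∀ {n} → Vec Bool n → ℕ → ℕ
prefixOnes _       zero    = 0
prefixOnes []      (suc m) = 0
prefixOnes (b ∷ x) (suc m) = bit b + prefixOnes x m

prefixOnes-suc : ∀ {n} (x : Vec Bool n) (i : Fin n) →
  prefixOnes x (suc (toℕ i)) ≡ bit (lookup x i) + prefixOnes x (toℕ i)
prefixOnes-suc (b ∷ x) fzero    = refl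
prefixOnes-suc (b ∷ x) (fsuc i) rewrite prefixOnes-suc x i =
  x∙yz≈y∙xz (bit b) (bit (lookup x i)) (prefixOnes x (toℕ i))

prefixOnes≤⇒pos≤ : ∀ {n} (x y : Vec Bool n) d →
  (∀ m → m ≤ n → prefixOnes x m ≤ d + prefixOnes y m) →
  ∀ k → pos y k ≤ pos x (d + k)
prefixOnes≤⇒pos≤ []          []          d h k       = z≤n
prefixOnes≤⇒pos≤ (_ ∷ x)     (true ∷ y)  d h zero    = z≤n
prefixOnes≤⇒pos≤ (true ∷ x)  (true ∷ y)  d h (suc k) rewrite +-suc d k =
  s≤s (prefixOnes≤⇒pos≤ x y d
         (λ m m≤n → ≤-pred (subst (suc (prefixOnes x m) ≤_) (+-suc d _) (h (suc m) (s≤s m≤n)))) k)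
prefixOnes≤⇒pos≤ (false ∷ x) (true ∷ y)  d h (suc k) rewrite +-suc d k =
  s≤s (prefixOnes≤⇒pos≤ x y (suc d)
         (λ m m≤n → subst (prefixOnes x m ≤_) (+-suc d _) (h (suc m) (s≤s m≤n))) k)
prefixOnes≤⇒pos≤ (false ∷ x) (false ∷ y) d h k =
  s≤s (prefixOnes≤⇒pos≤ x y d (λ m m≤n → h (suc m) (s≤s m≤n)) k)
prefixOnes≤⇒pos≤ (true ∷ x)  (false ∷ y) zero    h k = contradiction (h 1 (s≤s z≤n)) λ ()
prefixOnes≤⇒pos≤ (true ∷ x)  (false ∷ y) (suc d) h k =
  s≤s (prefixOnes≤⇒pos≤ x y d (λ m m≤n → ≤-pred (h (suc m) (s≤s m≤n))) k)

bounded-induction : ∀ {n} (P : ℕ → Set) → P 0 →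
  (∀ (i : Fin n) → P (toℕ i) → P (suc (toℕ i))) → ∀ m → m ≤ n → P m
bounded-induction P base step zero    _   = base
bounded-induction P base step (suc m) m<n =
  subst (P ∘ suc) (toℕ-fromℕ< m<n)
    (step (fromℕ< m<n) (subst P (sym (toℕ-fromℕ< m<n)) (bounded-induction P base step m (<⇒≤ m<n))))

∈-tabulate-<ᵇ⁻ : ∀ {n} (g : Fin n → ℕ) {m e} → e ∈ tabulate (λ e → g e <ᵇ m) → g e < m
∈-tabulate-<ᵇ⁻ g {m} {e} e∈ =
  <ᵇ⇒< _ _ (Equivalence.from T-≡ (trans (sym (lookup∘tabulate (λ e → g e <ᵇ m) e)) ([]=⇒lookup e∈)))

∈-tabulate-<ᵇ⁺ : ∀ {n} (g : Fin n → ℕ) {m e} → g e < m → e ∈ tabulate (λ e → g e <ᵇ m)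
∈-tabulate-<ᵇ⁺ g {m} {e} ge<m =
  lookup⇒[]= e _ (trans (lookup∘tabulate (λ e → g e <ᵇ m) e) (Equivalence.to T-≡ (<⇒<ᵇ ge<m)))

∣p∪q∣≤∣p∣+∣q∣ : ∀ {n} (p q : Subset n) → ∣ p ∪ q ∣ ≤ ∣ p ∣ + ∣ q ∣
∣p∪q∣≤∣p∣+∣q∣ []          []          = z≤n
∣p∪q∣≤∣p∣+∣q∣ (true ∷ p)  (b ∷ q)     = s≤s (≤-trans (∣p∪q∣≤∣p∣+∣q∣ p q) (+-monoʳ-≤ ∣ p ∣ (∣p∣≤∣x∷p∣ b q)))
∣p∪q∣≤∣p∣+∣q∣ (false ∷ p) (true ∷ q)  rewrite +-suc ∣ p ∣ ∣ q ∣ = s≤s (∣p∪q∣≤∣p∣+∣q∣ p q)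
∣p∪q∣≤∣p∣+∣q∣ (false ∷ p) (false ∷ q) = ∣p∪q∣≤∣p∣+∣q∣ p q

∣p∣≡sum-bit : ∀ {n} (p : Subset n) → ∣ p ∣ ≡ sum (bit ∘ lookup p)
∣p∣≡sum-bit []          = refl
∣p∣≡sum-bit (true ∷ p)  = cong suc (∣p∣≡sum-bit p)
∣p∣≡sum-bit (false ∷ p) = ∣p∣≡sum-bit p

preimage : ∀ {n} → Permutation′ n → Subset n → Subset n
preimage π p = tabulate (λ e → lookup p (π ⟨$⟩ʳ e))

∈-preimage⁺ : ∀ {n} (π : Permutation′ n) {p e} → π ⟨$⟩ʳ e ∈ p → e ∈ preimage π p
∈-preimage⁺ π {p} {e} πe∈p = lookup⇒[]= e _ (trans (lookup∘tabulate _ e) ([]=⇒lookup πe∈p))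

∈-preimage⁻ : ∀ {n} (π : Permutation′ n) {p e} → e ∈ preimage π p → π ⟨$⟩ʳ e ∈ p
∈-preimage⁻ π {p} {e} e∈ = lookup⇒[]= _ p (trans (sym (lookup∘tabulate _ e)) ([]=⇒lookup e∈))

∣preimage∣≡∣p∣ : ∀ {n} (π : Permutation′ n) (p : Subset n) → ∣ preimage π p ∣ ≡ ∣ p ∣
∣preimage∣≡∣p∣ π p = begin
  ∣ preimage π p ∣                  ≡⟨ ∣p∣≡sum-bit (preimage π p) ⟩
  sum (bit ∘ lookup (preimage π p)) ≡⟨ sum-cong-≗ (cong bit ∘ lookup∘tabulate (lookup p ∘ (π ⟨$⟩ʳ_))) ⟩
  sum (bit ∘ lookup p ∘ (π ⟨$⟩ʳ_))  ≡⟨ sum-permute (bit ∘ lookup p) π ⟨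
  sum (bit ∘ lookup p)              ≡⟨ ∣p∣≡sum-bit p ⟨
  ∣ p ∣                             ∎
  where open ≡-Reasoning

p⊆preimage⇒∣p∣≤∣q∣ : ∀ {n} (π : Permutation′ n) (p q : Subset n) → p ⊆ preimage π q → ∣ p ∣ ≤ ∣ q ∣
p⊆preimage⇒∣p∣≤∣q∣ π p q p⊆ = ≤-trans (p⊆q⇒∣p∣≤∣q∣ p⊆) (≤-reflexive (∣preimage∣≡∣p∣ π q))

transpose-i : ∀ {n} (i j : Fin n) → transpose i j i ≡ j
transpose-i i j rewrite dec-true (i ≟ᶠ i) refl = refl

transpose-j : ∀ {n} (i j : Fin n) → transpose i j j ≡ i
transpose-j i j with j ≟ᶠ i
... | yes j≡i = j≡i
... | no  _   rewrite dec-true (j ≟ᶠ j) refl = refl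

transpose-other : ∀ {n} (i j k : Fin n) → k ≢ i → k ≢ j → transpose i j k ≡ k
transpose-other i j k k≢i k≢j rewrite dec-false (k ≟ᶠ i) k≢i | dec-false (k ≟ᶠ j) k≢j = refl

data TransposeCase {n} (i j k : Fin n) : Set where
  at-i      : k ≡ i → transpose i j k ≡ j → TransposeCase i j k
  at-j      : k ≡ j → transpose i j k ≡ i → TransposeCase i j k
  elsewhere : transpose i j k ≡ k → TransposeCase i j k

transpose-case : ∀ {n} (i j k : Fin n) → TransposeCase i j k
transpose-case i j k with k ≟ᶠ i | k ≟ᶠ j
... | yes refl | _        = at-i refl (transpose-i i j)
... | no  _    | yes refl = at-j refl (transpose-j i j)
... | no  k≢i  | no  k≢j  = elsewhere (transpose-other i j k k≢i k≢j)

transpose-involutive : ∀ {n} (i j k : Fin n) → transpose i j (transpose i j k) ≡ k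
transpose-involutive i j k with transpose-case i j k
... | at-i refl tk≡j = trans (cong (transpose i j) tk≡j) (transpose-j i j)
... | at-j refl tk≡i = trans (cong (transpose i j) tk≡i) (transpose-i i j)
... | elsewhere tk≡k = trans (cong (transpose i j) tk≡k) tk≡k

prefix : ∀ {n} → Permutation′ n → ℕ → Subset n
prefix σ m = tabulate (λ e → toℕ (σ ⟨$⟩ˡ e) <ᵇ m)

module _ {n} (σ : Permutation′ n) where

  ∈-prefix⁻ : ∀ {m e} → e ∈ prefix σ m → toℕ (σ ⟨$⟩ˡ e) < m
  ∈-prefix⁻ = ∈-tabulate-<ᵇ⁻ (toℕ ∘ (σ ⟨$⟩ˡ_))

  ∈-prefix⁺ : ∀ {m e} → toℕ (σ ⟨$⟩ˡ e) < m → e ∈ prefix σ m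
  ∈-prefix⁺ = ∈-tabulate-<ᵇ⁺ (toℕ ∘ (σ ⟨$⟩ˡ_))

  prefix-suc⊆ : ∀ i → prefix σ (suc (toℕ i)) ⊆ prefix σ (toℕ i) ∪ ⁅ σ ⟨$⟩ʳ i ⁆
  prefix-suc⊆ i {e} e∈ with m<1+n⇒m<n∨m≡n (∈-prefix⁻ e∈)
  ... | inj₁ lt = x∈p∪q⁺ (inj₁ (∈-prefix⁺ lt))
  ... | inj₂ eq = x∈p∪q⁺ (inj₂ (subst (_∈ ⁅ σ ⟨$⟩ʳ i ⁆)
                    (trans (cong (σ ⟨$⟩ʳ_) (sym (toℕ-injective eq))) (inverseʳ σ)) (x∈⁅x⁆ _)))

  prefix∪⊆prefix-suc : ∀ i → prefix σ (toℕ i) ∪ ⁅ σ ⟨$⟩ʳ i ⁆ ⊆ prefix σ (suc (toℕ i))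
  prefix∪⊆prefix-suc i {e} e∈ with x∈p∪q⁻ (prefix σ (toℕ i)) _ e∈
  ... | inj₁ e∈prefix = ∈-prefix⁺ (m<n⇒m<1+n (∈-prefix⁻ e∈prefix))
  ... | inj₂ e∈⁅σi⁆ with x∈⁅y⁆⇒x≡y _ e∈⁅σi⁆
  ...   | refl = ∈-prefix⁺ (subst (λ k → toℕ k < suc (toℕ i)) (sym (inverseˡ σ)) ≤-refl)

RankAtMost : ∀ {n} → IndepPred n → Subset n → ℕ → Set
RankAtMost Ind A c = ∀ I → I ⊆ A → Ind I → ∣ I ∣ ≤ c

RankAtLeast : ∀ {n} → IndepPred n → Subset n → ℕ → Set
RankAtLeast Ind A c = ∃[ I ] (I ⊆ A × Ind I × c ≤ ∣ I ∣)

Hereditary : ∀ {n} → IndepPred n → Set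
Hereditary Ind = ∀ {I J} → J ⊆ I → Ind I → Ind J

rank-stalls⇒∈closure : ∀ {n} (Ind : IndepPred n) (σ : Permutation′ n) i c →
  RankAtLeast Ind (prefix σ (toℕ i)) c → ¬ RankAtLeast Ind (prefix σ (suc (toℕ i))) (suc c) →
  InClosure Ind (prefixσ σ i) (σ ⟨$⟩ʳ i)
rank-stalls⇒∈closure Ind σ i c (J , J⊆ , indJ , c≤∣J∣) ¬rank≥ I I⊆ indI with ∣ I ∣ ≤? c
... | yes ∣I∣≤c = J , J⊆ , indJ , ≤-trans ∣I∣≤c c≤∣J∣
... | no  ∣I∣≰c = ⊥-elim (¬rank≥ (I , (λ {_} e∈I → prefix∪⊆prefix-suc σ i (I⊆ e∈I)) , indI , ≰⇒> ∣I∣≰c))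

-- The lower bound is only reachable doubly negated, since closure is defined by a
-- universal statement.
module DistinguishedWord {n} (Ind : IndepPred n) (σ : Permutation′ n) (x : Vec Bool n)
                         (x-dist : IsDistWord Ind σ x) where

  rankAtMost-suc : Hereditary Ind → ∀ i c → RankAtMost Ind (prefix σ (toℕ i)) c →
    RankAtMost Ind (prefix σ (suc (toℕ i))) (bit (lookup x i) + c)
  rankAtMost-suc hered i c rank≤ I I⊆ indI with lookup x i in xᵢ≡
  ... | false =
    let (J , J⊆ , indJ , ∣I∣≤∣J∣) =
          Equivalence.to (x-dist i) xᵢ≡ I (λ {_} e∈I → prefix-suc⊆ σ i (I⊆ e∈I)) indI
    in ≤-trans ∣I∣≤∣J∣ (rank≤ J J⊆ indJ)
  ... | true = begin
    ∣ I ∣                ≤⟨ p⊆q⇒∣p∣≤∣q∣ I⊆⁅σᵢ⁆∪I∩A ⟩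
    ∣ ⁅ σᵢ ⁆ ∪ (I ∩ A) ∣ ≤⟨ ∣p∪q∣≤∣p∣+∣q∣ ⁅ σᵢ ⁆ (I ∩ A) ⟩
    ∣ ⁅ σᵢ ⁆ ∣ + ∣ I ∩ A ∣ ≡⟨ cong (_+ ∣ I ∩ A ∣) (∣⁅x⁆∣≡1 σᵢ) ⟩
    suc ∣ I ∩ A ∣        ≤⟨ s≤s (rank≤ (I ∩ A) (p∩q⊆q I A) (hered (p∩q⊆p I A) indI)) ⟩
    suc c                ∎
    where
    open ≤-Reasoning
    A = prefix σ (toℕ i)
    σᵢ = σ ⟨$⟩ʳ i
    I⊆⁅σᵢ⁆∪I∩A : I ⊆ ⁅ σᵢ ⁆ ∪ (I ∩ A)
    I⊆⁅σᵢ⁆∪I∩A {e} e∈I with x∈p∪q⁻ A _ (prefix-suc⊆ σ i (I⊆ e∈I))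
    ... | inj₁ e∈A  = x∈p∪q⁺ (inj₂ (x∈p∩q⁺ (e∈I , e∈A)))
    ... | inj₂ e≡σᵢ = x∈p∪q⁺ (inj₁ e≡σᵢ)

  rankAtLeast-suc : ∀ i c → ¬ ¬ RankAtLeast Ind (prefix σ (toℕ i)) c →
    ¬ ¬ RankAtLeast Ind (prefix σ (suc (toℕ i))) (bit (lookup x i) + c)
  rankAtLeast-suc i c ¬¬rank≥ with lookup x i in xᵢ≡
  ... | false = ¬¬-map (λ (I , I⊆ , indI , c≤∣I∣) →
                  I , (λ {_} e∈I → prefix∪⊆prefix-suc σ i (x∈p∪q⁺ (inj₁ (I⊆ e∈I)))) , indI , c≤∣I∣) ¬¬rank≥
  ... | true  = λ ¬rank≥ → ¬¬rank≥ λ rank≥ →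
    let xᵢ≡false = Equivalence.from (x-dist i) (rank-stalls⇒∈closure Ind σ i c rank≥ ¬rank≥)
    in contradiction (trans (sym xᵢ≡) xᵢ≡false) λ ()

  prefix-rank≤ : Hereditary Ind → ∀ m → m ≤ n → RankAtMost Ind (prefix σ m) (prefixOnes x m)
  prefix-rank≤ hered = bounded-induction (λ m → RankAtMost Ind (prefix σ m) (prefixOnes x m))
    (λ I I⊆ _ → ≤-trans (p⊆q⇒∣p∣≤∣q∣ {q = ∅} (λ e∈ → ⊥-elim (n≮0 (∈-prefix⁻ σ (I⊆ e∈)))))
                        (≤-reflexive (∣⊥∣≡0 n)))
    (λ i rank≤ → subst (RankAtMost Ind _) (sym (prefixOnes-suc x i)) (rankAtMost-suc hered i _ rank≤))

  prefix-rank≥ : Ind ∅ → ∀ m → m ≤ n → ¬ ¬ RankAtLeast Ind (prefix σ m) (prefixOnes x m)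
  prefix-rank≥ ind∅ = bounded-induction (λ m → ¬ ¬ RankAtLeast Ind (prefix σ m) (prefixOnes x m))
    (λ ¬rank≥ → ¬rank≥ (∅ , (λ {_} e∈∅ → ⊥-elim (∉⊥ e∈∅)) , ind∅ , z≤n))
    (λ i ¬¬rank≥ → subst (λ c → ¬ ¬ RankAtLeast Ind _ c) (sym (prefixOnes-suc x i))
                         (rankAtLeast-suc i _ ¬¬rank≥))

module _ {n} (r : ℕ) (w : Vec Bool n) where

  Mw-shift-down : ∀ (π : Permutation′ n) {I J} →
    (∀ {e} → e ∈ J → π ⟨$⟩ʳ e ∈ I × toℕ (π ⟨$⟩ʳ e) ≤ toℕ e) → Mw r w I → Mw r w J
  Mw-shift-down π {I} {J} shift (∣I∩S∣≤ , ∣I∣≤r) =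
    (λ k k<r → ≤-trans (∣J∩S∣≤∣I∩S∣ (pos w k)) (∣I∩S∣≤ k k<r)) ,
    ≤-trans (p⊆preimage⇒∣p∣≤∣q∣ π J I (λ e∈ → ∈-preimage⁺ π (proj₁ (shift e∈)))) ∣I∣≤r
    where
    J∩S↦I∩S : ∀ {s e} → e ∈ J ∩ initSeg s → π ⟨$⟩ʳ e ∈ I ∩ initSeg s
    J∩S↦I∩S {s} e∈J∩S with x∈p∩q⁻ J _ e∈J∩S
    ... | e∈J , e∈S = x∈p∩q⁺ (proj₁ (shift e∈J) ,
          ∈-tabulate-<ᵇ⁺ toℕ {s} (≤-<-trans (proj₂ (shift e∈J)) (∈-tabulate-<ᵇ⁻ toℕ e∈S)))
    ∣J∩S∣≤∣I∩S∣ : ∀ s → ∣ J ∩ initSeg s ∣ ≤ ∣ I ∩ initSeg s ∣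
    ∣J∩S∣≤∣I∩S∣ s = p⊆preimage⇒∣p∣≤∣q∣ π (J ∩ initSeg s) (I ∩ initSeg s)
                      (λ e∈ → ∈-preimage⁺ π (J∩S↦I∩S {s} e∈))

  Mw-hereditary : Hereditary (Mw r w)
  Mw-hereditary J⊆I = Mw-shift-down id (λ e∈J → J⊆I e∈J , ≤-refl)

  Mw-∅ : Mw r w ∅
  Mw-∅ = (λ k _ → ≤-trans (∣p∩q∣≤∣p∣ (∅ {n}) _) ∣∅∣≤) , ∣∅∣≤
    where
    ∣∅∣≤ : ∀ {k} → ∣ ∅ {n} ∣ ≤ k
    ∣∅∣≤ = ≤-trans (≤-reflexive (∣⊥∣≡0 n)) z≤n

  module Cover (σ τ : Permutation′ n) (i j : Fin n) (i<j : toℕ i < toℕ j)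
               (a<b : toℕ (σ ⟨$⟩ʳ i) < toℕ (σ ⟨$⟩ʳ j))
               (τ≡σ∘t : ∀ k → τ ⟨$⟩ʳ k ≡ σ ⟨$⟩ʳ transpose i j k) where

    b : Fin n
    b = σ ⟨$⟩ʳ j

    τ⁻¹≡t∘σ⁻¹ : ∀ e → τ ⟨$⟩ˡ e ≡ transpose i j (σ ⟨$⟩ˡ e)
    τ⁻¹≡t∘σ⁻¹ e = trans (cong (τ ⟨$⟩ˡ_) (sym τt≡id)) (inverseˡ τ)
      where
      τt≡id : τ ⟨$⟩ʳ transpose i j (σ ⟨$⟩ˡ e) ≡ e
      τt≡id = trans (τ≡σ∘t _) (trans (cong (σ ⟨$⟩ʳ_) (transpose-involutive i j _)) (inverseʳ σ))

    σ⁻¹≡⇒≡σ : ∀ {e k} → σ ⟨$⟩ˡ e ≡ k → e ≡ σ ⟨$⟩ʳ k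
    σ⁻¹≡⇒≡σ σ⁻¹e≡k = trans (sym (inverseʳ σ)) (cong (σ ⟨$⟩ʳ_) σ⁻¹e≡k)

    -- exchanges the values σ ⟨$⟩ʳ i and b
    ρ : Permutation′ n
    ρ = flip σ ∘ₚ transposeₚ i j ∘ₚ σ

    preimage-prefixσ⊆prefixτ : ∀ {m} → preimage ρ (prefix σ m) ⊆ prefix τ m
    preimage-prefixσ⊆prefixτ {m} {e} e∈ = ∈-prefix⁺ τ (subst (λ k → toℕ k < m)
      (trans (inverseˡ σ) (sym (τ⁻¹≡t∘σ⁻¹ e))) (∈-prefix⁻ σ (∈-preimage⁻ ρ e∈)))

    prefixσ⊆prefixτ : ∀ {m} → b ∈ prefix σ m → prefix σ m ⊆ prefix τ m
    prefixσ⊆prefixτ {m} b∈ {e} e∈ =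
      ∈-prefix⁺ τ (subst (λ k → toℕ k < m) (sym (τ⁻¹≡t∘σ⁻¹ e)) t∘σ⁻¹e<m)
      where
      σ⁻¹e<m = ∈-prefix⁻ σ e∈
      t∘σ⁻¹e<m : toℕ (transpose i j (σ ⟨$⟩ˡ e)) < m
      t∘σ⁻¹e<m with transpose-case i j (σ ⟨$⟩ˡ e)
      ... | at-i _ t≡j = subst (λ k → toℕ k < m) (trans (inverseˡ σ) (sym t≡j)) (∈-prefix⁻ σ b∈)
      ... | at-j σ⁻¹e≡j t≡i rewrite t≡i = <-trans i<j (subst (λ k → toℕ k < m) σ⁻¹e≡j σ⁻¹e<m)
      ... | elsewhere t≡id rewrite t≡id = σ⁻¹e<m

    ρ-lowers : ∀ {I} → b ∉ I → ∀ {e} → ρ ⟨$⟩ʳ e ∈ I → toℕ (ρ ⟨$⟩ʳ e) ≤ toℕ e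
    ρ-lowers b∉I {e} ρe∈I with transpose-case i j (σ ⟨$⟩ˡ e)
    ... | at-i _ t≡j = contradiction (subst (_∈ _) (cong (σ ⟨$⟩ʳ_) t≡j) ρe∈I) b∉I
    ... | at-j σ⁻¹e≡j t≡i rewrite t≡i | σ⁻¹≡⇒≡σ σ⁻¹e≡j = <⇒≤ a<b
    ... | elsewhere t≡id rewrite t≡id | inverseʳ σ {e} = ≤-refl

    cover-rank≥ : ∀ m c → RankAtLeast (Mw r w) (prefix σ m) c → RankAtLeast (Mw r w) (prefix τ m) c
    cover-rank≥ m c (I , I⊆ , indI , c≤∣I∣) with b ∈? I
    ... | yes b∈I = I , (λ {_} e∈I → prefixσ⊆prefixτ {m} (I⊆ b∈I) (I⊆ e∈I)) , indI , c≤∣I∣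
    ... | no  b∉I =
      preimage ρ I ,
      (λ {_} e∈ → preimage-prefixσ⊆prefixτ {m} (∈-preimage⁺ ρ (I⊆ (∈-preimage⁻ ρ {I} e∈)))) ,
      Mw-shift-down ρ {I} (λ e∈ → ∈-preimage⁻ ρ {I} e∈ , ρ-lowers b∉I (∈-preimage⁻ ρ {I} e∈)) indI ,
      ≤-trans c≤∣I∣ (≤-reflexive (sym (∣preimage∣≡∣p∣ ρ I)))

  ≤B-rank≥ : ∀ {σ τ : Permutation′ n} → σ ≤B τ →
    ∀ m c → RankAtLeast (Mw r w) (prefix σ m) c → RankAtLeast (Mw r w) (prefix τ m) c
  ≤B-rank≥ ε m c rank≥ = rank≥
  ≤B-rank≥ {σ} (_◅_ {j = τ} (i , j , i<j , a<b , τ≡σ∘t , _) τ≤B) m c rank≥ =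
    ≤B-rank≥ τ≤B m c (Cover.cover-rank≥ σ τ i j i<j a<b τ≡σ∘t m c rank≥)

proposition7p8 : (n r : ℕ) (w : Vec Bool n) → InW n r w →
    (σ τ : Permutation′ n) → σ ≤B τ →
    (x y : Vec Bool n) → IsDistWord (Mw r w) σ x → IsDistWord (Mw r w) τ y →
    y ≤W[ r ] x
proposition7p8 n r w _ σ τ σ≤τ x y x-dist y-dist k _ =
  prefixOnes≤⇒pos≤ x y 0 prefixOnes-x≤y k
  where
  open DistinguishedWord
  prefixOnes-x≤y : ∀ m → m ≤ n → prefixOnes x m ≤ prefixOnes y m
  prefixOnes-x≤y m m≤n = decidable-stable (prefixOnes x m ≤? prefixOnes y m)
    (¬¬-map (λ rank≥ → let (I , I⊆ , indI , c≤∣I∣) = ≤B-rank≥ r w σ≤τ m _ rank≥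
                       in ≤-trans c≤∣I∣ (rank≤ I I⊆ indI))
            (prefix-rank≥ (Mw r w) σ x x-dist (Mw-∅ r w) m m≤n))
    where rank≤ = prefix-rank≤ (Mw r w) τ y y-dist (Mw-hereditary r w) m m≤n
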